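{- Let $G=(V,E)$ be a finite undirected loopless graph (parallel edges allowed), and let $f:V\to\mathbb{Z}\cup\{ -\infty\}$, $g:V\to\mathbb{Z}\cup\{+\infty\}$ with $f\le g$ be such that $G$ has an $(f,g)$-bounded orientation. An $(f,g)$-bounded orientation $D$ of $G$ is decreasingly minimal (among $(f,g)$-bounded orientations of $G$) if and only if there is no directed path in $D$ from a node $s$ to a node $t$ with $\varrho_D(t)\ge\varrho_D(s)+2$, $\varrho_D(s)<g(s)$ and $\varrho_D(t)>f(t)$.
   Context: $\varrho_D(v)$ is the in-degree of node $v$ in $D$. An orientation $D$ is $(f,g)$-bounded if $f(v)\le\varrho_D(v)\le g(v)$ for all $v\in V$. An orientation is decreasingly minimal among a family of orientations if its in-degree vector, sorted in decreasing order, is lexicographically smaller than or equal to that of every member of the family sorted likewise. -}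

module Defs where

open import Data.Nat using (ℕ; zero; suc; _+_; _≤_; _<_)
open import Data.Integer as ℤ using (ℤ; +_)
open import Data.Fin using (Fin)
open import Data.Fin.Properties using () renaming (_≟_ to _≟ᶠ_)
open import Data.Bool using (Bool; true; false)
open import Data.Maybe using (Maybe; just; nothing)
open import Data.Product using (_×_; _,_; proj₁; proj₂)
open import Data.List using (List; []; _∷_; length; filter; allFin; reverse; map)
open import Data.List.Relation.Unary.Unique.Propositional using (Unique)
open import Data.Unit using (⊤)
open import Data.Empty using (⊥)
open import Relation.Binary.PropositionalEquality using (_≡_; _≢_)
import Data.Nat.Properties as ℕP
open import Data.List.Sort ℕP.≤-decTotalOrder using (sort)

record Graph (n : ℕ) : Set where
  field
    m        : ℕ
    ends     : Fin m → Fin n × Fin n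
    loopless : ∀ i → proj₁ (ends i) ≢ proj₂ (ends i)
open Graph public

-- An orientation chooses a direction for each edge:
-- false : proj₁ → proj₂ ,  true : proj₂ → proj₁
Orientation : ∀ {n} → Graph n → Set
Orientation G = Fin (m G) → Bool

tailOf headOf : ∀ {n} (G : Graph n) → Orientation G → Fin (m G) → Fin n
tailOf G D i with D i
... | false = proj₁ (ends G i)
... | true  = proj₂ (ends G i)
headOf G D i with D i
... | false = proj₂ (ends G i)
... | true  = proj₁ (ends G i)

inDeg : ∀ {n} (G : Graph n) → Orientation G → Fin n → ℕ
inDeg G D v = length (filter (λ i → headOf G D i ≟ᶠ v) (allFin (m G)))

-- Extended bounds: f : V → ℤ ∪ {-∞} (nothing = -∞),
--                  g : V → ℤ ∪ {+∞} (nothing = +∞).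
LowerBound UpperBound : Set
LowerBound = Maybe ℤ
UpperBound = Maybe ℤ

_≤ᴸ_ : LowerBound → ℕ → Set
nothing ≤ᴸ k = ⊤
just a  ≤ᴸ k = a ℤ.≤ + k

_≤ᵁ_ : ℕ → UpperBound → Set
k ≤ᵁ nothing = ⊤
k ≤ᵁ just b  = + k ℤ.≤ b

_<ᴸ_ : LowerBound → ℕ → Set
nothing <ᴸ k = ⊤
just a  <ᴸ k = a ℤ.< + k

_<ᵁ_ : ℕ → UpperBound → Set
k <ᵁ nothing = ⊤
k <ᵁ just b  = + k ℤ.< b

_≤ᴸᵁ_ : LowerBound → UpperBound → Set
nothing ≤ᴸᵁ _      = ⊤
just a  ≤ᴸᵁ nothing = ⊤
just a  ≤ᴸᵁ just b  = a ℤ.≤ b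

Bounded : ∀ {n} (G : Graph n) → (Fin n → LowerBound) → (Fin n → UpperBound) → Orientation G → Set
Bounded G f g D = ∀ v → (f v ≤ᴸ inDeg G D v) × (inDeg G D v ≤ᵁ g v)

inDegList : ∀ {n} (G : Graph n) → Orientation G → List ℕ
inDegList {n} G D = map (inDeg G D) (allFin n)

sortDec : List ℕ → List ℕ
sortDec xs = reverse (sort xs)

data LexLeq : List ℕ → List ℕ → Set where
  []≤  : ∀ {ys} → LexLeq [] ys
  here : ∀ {x y xs ys} → x < y → LexLeq (x ∷ xs) (y ∷ ys)
  next : ∀ {x xs ys} → LexLeq xs ys → LexLeq (x ∷ xs) (x ∷ ys)

DecMin : ∀ {n} (G : Graph n) → (Fin n → LowerBound) → (Fin n → UpperBound) → Orientation G → Set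
DecMin G f g D = ∀ D' → Bounded G f g D' →
  LexLeq (sortDec (inDegList G D)) (sortDec (inDegList G D'))

data Walk {n} (G : Graph n) (D : Orientation G) : Fin n → Fin n → Set where
  [] : ∀ {s} → Walk G D s s
  _∷_ : ∀ {t} (i : Fin (m G)) → Walk G D (headOf G D i) t → Walk G D (tailOf G D i) t

walkNodes : ∀ {n} {G : Graph n} {D : Orientation G} {s t} → Walk G D s t → List (Fin n)
walkNodes {s = s} []      = s ∷ []
walkNodes {s = s} (i ∷ w) = s ∷ walkNodes w

record DiPath {n} (G : Graph n) (D : Orientation G) (s t : Fin n) : Set where
  field
    walk     : Walk G D s t
    distinct : Unique (walkNodes walk)

module Submission where

-- Reversing an improving path s → t moves one unit of in-degree from t to s; as
-- ϱ(t) ≥ ϱ(s) + 2 this makes the decreasingly sorted in-degree vector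
-- lexicographically smaller, and the bounds at s and t keep the new orientation
-- (f,g)-bounded.  Conversely, let D have no improving path and let D′ be bounded.
-- If ϱ_D′(s) > ϱ_D(s), following arcs of D that are reversed in D′ leads from s to
-- a node t with ϱ_D′(t) < ϱ_D(t).  Restoring D's direction along a path from s to t
-- gives a bounded D″ that differs from D on fewer arcs; since D has no improving
-- path, ϱ_D(t) ≤ ϱ_D(s) + 1, whence D″ is not larger than D′.  Induction on the
-- number of disagreeing arcs concludes, the base case being D′ with the in-degrees
-- of D (a node with a deficit would lead, in the same way, to one with a surplus).

open import Defs

open import Data.Bool using (true; false; not; if_then_else_)
import Data.Bool.Properties as Bool
open import Data.Fin using (Fin; zero; suc; punchIn; punchOut)
open import Data.Fin.Properties using (any?; punchInᵢ≢i; punchIn-injective; punchIn-punchOut) renaming (_≟_ to _≟ᶠ_)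
import Data.Integer as ℤ
import Data.Integer.Properties as ℤ
open import Data.List using (List; []; _∷_; length; filter; reverse; tabulate; map; allFin)
open import Data.List.Membership.Propositional using (_∈_; _∉_)
import Data.List.Membership.DecPropositional as DecMembership
open import Data.List.Properties using (reverse-involutive; unfold-reverse; map-tabulate; map-cong; tabulate-cong)
open import Data.List.Relation.Binary.Permutation.Propositional using (_↭_; ↭-sym; ↭-trans; ↭-refl; prep; swap; ↭⇒↭ₛ)
open import Data.List.Relation.Binary.Permutation.Propositional.Properties using (↭-reverse; All-resp-↭)
open import Data.List.Relation.Binary.Pointwise using (Pointwise-≡⇒≡)
open import Data.List.Relation.Unary.All as All using (All; []; _∷_)
open import Data.List.Relation.Unary.All.Properties using (¬Any⇒All¬)
open import Data.List.Relation.Unary.AllPairs using (AllPairs; []; _∷_)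
import Data.List.Relation.Unary.AllPairs.Properties as AllPairs
open import Data.List.Relation.Unary.Any as Any using (here; there)
open import Data.List.Relation.Unary.Sorted.TotalOrder.Properties using (↗↭↗⇒≋; AllPairs⇒Sorted; Sorted⇒AllPairs)
open import Data.List.Relation.Unary.Unique.Propositional using (Unique)
open import Data.Maybe using (just; nothing)
open import Data.Nat using (ℕ; zero; suc; _+_; _≤_; _<_; _≥_; z≤n; s≤s; _≤ᵇ_; _<?_)
open import Data.Nat.Induction using (<-wellFounded)
import Data.Nat.Properties as ℕ
open import Algebra.Properties.CommutativeMonoid.Sum ℕ.+-0-commutativeMonoid
  using (sum; sum-syntax; sum-cong-≗; sum-remove)
open import Algebra.Properties.CommutativeSemigroup ℕ.+-commutativeSemigroup using (xy∙z≈xz∙y; xy∙z≈zy∙x)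
open import Data.List.Sort ℕ.≤-decTotalOrder using (sort; sort-↭; sort-↗)
open import Data.Product using (Σ; _×_; _,_; proj₁; proj₂)
open import Data.Sum using (_⊎_; inj₁; inj₂)
open import Data.Vec.Functional using (removeAt)
open import Function using (flip; _∘_; id)
open import Function.Bundles using (_⇔_; mk⇔)
open import Induction.WellFounded using (Acc; acc)
open import Relation.Binary using (Rel)
open import Relation.Binary.Bundles using (DecTotalOrder)
import Relation.Binary.Construct.Flip.EqAndOrd as Flip
open import Relation.Binary.Definitions using (tri<; tri≈; tri>)
open import Relation.Binary.PropositionalEquality
open import Relation.Nullary using (¬_; Dec; yes; no; does; ¬?; _×-dec_; contradiction)
open import Relation.Nullary.Decidable using (toSum)
open import Relation.Unary using (Decidable)

data LexLt : List ℕ → List ℕ → Set where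
  here : ∀ {x y xs ys} → x < y → LexLt (x ∷ xs) (y ∷ ys)
  next : ∀ {x xs ys} → LexLt xs ys → LexLt (x ∷ xs) (x ∷ ys)

LexLt⇒LexLeq : ∀ {xs ys} → LexLt xs ys → LexLeq xs ys
LexLt⇒LexLeq (here x<y) = here x<y
LexLt⇒LexLeq (next lt)  = next (LexLt⇒LexLeq lt)

LexLeq-refl : ∀ xs → LexLeq xs xs
LexLeq-refl []       = []≤
LexLeq-refl (x ∷ xs) = next (LexLeq-refl xs)

LexLeq-trans : ∀ {xs ys zs} → LexLeq xs ys → LexLeq ys zs → LexLeq xs zs
LexLeq-trans []≤        _          = []≤
LexLeq-trans (here x<y) (here y<z) = here (ℕ.<-trans x<y y<z)
LexLeq-trans (here x<y) (next _)   = here x<y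
LexLeq-trans (next _)   (here y<z) = here y<z
LexLeq-trans (next p)   (next q)   = next (LexLeq-trans p q)

LexLeq⇒¬LexLt : ∀ {xs ys} → LexLeq xs ys → ¬ LexLt ys xs
LexLeq⇒¬LexLt (here x<y) (here y<x) = ℕ.<-asym x<y y<x
LexLeq⇒¬LexLt (here x<x) (next _)   = ℕ.<-irrefl refl x<x
LexLeq⇒¬LexLt (next _)   (here x<x) = ℕ.<-irrefl refl x<x
LexLeq⇒¬LexLt (next p)   (next q)   = LexLeq⇒¬LexLt p q

AllPairs-reverse : ∀ {a ℓ} {A : Set a} {R : Rel A ℓ} {xs} → AllPairs R xs → AllPairs (flip R) (reverse xs)
AllPairs-reverse {xs = []}     []          = []
AllPairs-reverse {xs = x ∷ xs} (Rx ∷ Rxs) rewrite unfold-reverse x xs =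
  AllPairs.++⁺ (AllPairs-reverse Rxs) ([] ∷ [])
    (All.map (_∷ []) (All-resp-↭ (↭-sym (↭-reverse xs)) Rx))

≥-decTotalOrder : DecTotalOrder _ _ _
≥-decTotalOrder = Flip.decTotalOrder ℕ.≤-decTotalOrder

open import Data.List.Sort.InsertionSort.Base ≥-decTotalOrder using (insert) renaming (sort to sort≥)
open import Data.List.Sort.InsertionSort.Properties ≥-decTotalOrder using (insert-↭) renaming (sort-↭ to sort≥-↭; sort-↗ to sort≥-↗)

sort-unique : ∀ {xs ys} → xs ↭ ys → AllPairs _≤_ ys → sort xs ≡ ys
sort-unique {xs} xs↭ys ys↗ = Pointwise-≡⇒≡ (↗↭↗⇒≋ ℕ.≤-totalOrder (sort-↗ xs)
  (AllPairs⇒Sorted ℕ.≤-totalOrder ys↗) (↭⇒↭ₛ (↭-trans (sort-↭ xs) xs↭ys)))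

sortDec-↭ : ∀ {xs ys} → xs ↭ ys → sortDec xs ≡ sortDec ys
sortDec-↭ {ys = ys} xs↭ys = cong reverse
  (sort-unique (↭-trans xs↭ys (↭-sym (sort-↭ ys))) (Sorted⇒AllPairs ℕ.≤-totalOrder (sort-↗ ys)))

sortDec≡sort≥ : ∀ xs → sortDec xs ≡ sort≥ xs
sortDec≡sort≥ xs = begin
  reverse (sort xs)                ≡⟨ cong reverse (sort-unique (↭-sym (↭-trans (↭-reverse _) (sort≥-↭ xs)))
                                       (AllPairs-reverse (Sorted⇒AllPairs (DecTotalOrder.totalOrder ≥-decTotalOrder) (sort≥-↗ xs)))) ⟩
  reverse (reverse (sort≥ xs))     ≡⟨ reverse-involutive (sort≥ xs) ⟩
  sort≥ xs                         ∎
  where open ≡-Reasoning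

insert-≥ : ∀ {x y} ys → y ≤ x → insert x (y ∷ ys) ≡ x ∷ y ∷ ys
insert-≥ {x} {y} ys y≤x with y ≤ᵇ x | ℕ.≤⇒≤ᵇ y≤x
... | true | _ = refl

insert-< : ∀ {x y} ys → x < y → insert x (y ∷ ys) ≡ y ∷ insert x ys
insert-< {x} {y} ys x<y with y ≤ᵇ x | ℕ.≤ᵇ⇒≤ y x
... | true  | y≤x = contradiction (y≤x _) (ℕ.<⇒≱ x<y)
... | false | _   = refl

insert-head : ∀ {x} ys → All (_≤ x) ys → insert x ys ≡ x ∷ ys
insert-head []       []          = refl
insert-head (y ∷ ys) (y≤x ∷ _)   = insert-≥ ys y≤x

All-insert : ∀ {p} {P : ℕ → Set p} {x ys} → P x → All P ys → All P (insert x ys)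
All-insert {x = x} {ys} px pys = All-resp-↭ (↭-sym (insert-↭ x ys)) (px ∷ pys)

insert-smooth : ∀ {c d} L → AllPairs _≥_ L → c ≤ d →
  LexLt (insert (suc d) (insert (suc c) L)) (insert (2 + d) (insert c L))
insert-smooth {c} {d} [] [] c≤d
  rewrite insert-≥ [] (s≤s c≤d) | insert-≥ [] (ℕ.m≤n⇒m≤1+n (ℕ.m≤n⇒m≤1+n c≤d)) = here ℕ.≤-refl
insert-smooth {c} {d} (y ∷ L) (y≥L ∷ L↘) c≤d with ℕ.<-cmp y (2 + d)
... | tri< y<2+d _ _ =
  subst₂ LexLt (sym (insert-head _ (All-insert (s≤s c≤d) y∷L≤1+d)))
               (sym (insert-head _ (All-insert c≤2+d (All.map ℕ.m≤n⇒m≤1+n y∷L≤1+d))))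
               (here ℕ.≤-refl)
  where
  y∷L≤1+d : All (_≤ suc d) (y ∷ L)
  y∷L≤1+d = ℕ.≤-pred y<2+d ∷ All.map (λ z≤y → ℕ.≤-trans z≤y (ℕ.≤-pred y<2+d)) y≥L
  c≤2+d : c ≤ 2 + d
  c≤2+d = ℕ.m≤n⇒m≤1+n (ℕ.m≤n⇒m≤1+n c≤d)
... | tri≈ _ refl _
  rewrite insert-< L (s≤s (s≤s c≤d)) | insert-< L (s≤s (ℕ.m≤n⇒m≤1+n c≤d))
        | insert-< (insert (suc c) L) (ℕ.n<1+n (suc d)) | insert-≥ (insert c L) (ℕ.≤-refl {2 + d}) =
  next (subst (LexLt (insert (suc d) (insert (suc c) L)))
              (insert-head (insert c L) (All-insert (ℕ.m≤n⇒m≤1+n (ℕ.m≤n⇒m≤1+n c≤d)) y≥L))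
              (insert-smooth L L↘ c≤d))
... | tri> _ _ 2+d<y
  rewrite insert-< L (ℕ.<-trans (s≤s (s≤s c≤d)) 2+d<y) | insert-< L (ℕ.<-trans (s≤s (ℕ.m≤n⇒m≤1+n c≤d)) 2+d<y)
        | insert-< (insert (suc c) L) (ℕ.<-trans (ℕ.n<1+n (suc d)) 2+d<y)
        | insert-< (insert c L) 2+d<y =
  next (insert-smooth L L↘ c≤d)

sortDec-smooth : ∀ {c x} → c < x → ∀ Z → LexLt (sortDec (x ∷ suc c ∷ Z)) (sortDec (suc x ∷ c ∷ Z))
sortDec-smooth (s≤s c≤d) Z = subst₂ LexLt (sym (sortDec≡sort≥ _)) (sym (sortDec≡sort≥ _))
  (insert-smooth (sort≥ Z) (Sorted⇒AllPairs (DecTotalOrder.totalOrder ≥-decTotalOrder) (sort≥-↗ Z)) c≤d)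

sortDec-balanced : ∀ {x c} → x ≤ c → ∀ Z → LexLeq (sortDec (suc x ∷ c ∷ Z)) (sortDec (x ∷ suc c ∷ Z))
sortDec-balanced x≤c Z with ℕ.m≤n⇒m<n∨m≡n x≤c
... | inj₁ x<c  = LexLt⇒LexLeq (subst₂ LexLt (sortDec-↭ (swap _ _ ↭-refl)) (sortDec-↭ (swap _ _ ↭-refl))
                                 (sortDec-smooth x<c Z))
... | inj₂ refl = subst (LexLeq _) (sortDec-↭ (swap _ _ ↭-refl)) (LexLeq-refl _)

indicator : ∀ {p} {P : Set p} → Dec P → ℕ
indicator (yes _) = 1
indicator (no _)  = 0

indicator-yes : ∀ {p} {P : Set p} → P → (P? : Dec P) → indicator P? ≡ 1
indicator-yes p (yes _) = refl
indicator-yes p (no ¬p) = contradiction p ¬p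

indicator-no : ∀ {p} {P : Set p} → ¬ P → (P? : Dec P) → indicator P? ≡ 0
indicator-no ¬p (yes p) = contradiction p ¬p
indicator-no ¬p (no _)  = refl

indicator-mono : ∀ {p q} {P : Set p} {Q : Set q} → (P → Q) → (P? : Dec P) (Q? : Dec Q) → indicator P? ≤ indicator Q?
indicator-mono P⇒Q (yes p) (yes _) = ℕ.≤-refl
indicator-mono P⇒Q (yes p) (no ¬q) = contradiction (P⇒Q p) ¬q
indicator-mono P⇒Q (no _)  _       = z≤n

length-filter-tabulate : ∀ {a p n} {A : Set a} {P : A → Set p} (P? : Decidable P) (h : Fin n → A) →
  length (filter P? (tabulate h)) ≡ ∑[ i < n ] indicator (P? (h i))
length-filter-tabulate {n = zero}  P? h = refl
length-filter-tabulate {n = suc n} P? h with P? (h zero)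
... | yes _ = cong suc (length-filter-tabulate P? (h ∘ suc))
... | no _  = length-filter-tabulate P? (h ∘ suc)

∑-mono-≤ : ∀ {n} {u w : Fin n → ℕ} → (∀ i → u i ≤ w i) → sum u ≤ sum w
∑-mono-≤ {zero}  u≤w = z≤n
∑-mono-≤ {suc n} u≤w = ℕ.+-mono-≤ (u≤w zero) (∑-mono-≤ (u≤w ∘ suc))

∑-mono-< : ∀ {n} {u w : Fin n → ℕ} → (∀ i → u i ≤ w i) → ∀ i → u i < w i → sum u < sum w
∑-mono-< u≤w zero    u<w = ℕ.+-mono-<-≤ u<w (∑-mono-≤ (u≤w ∘ suc))
∑-mono-< u≤w (suc i) u<w = ℕ.+-mono-≤-< (u≤w zero) (∑-mono-< (u≤w ∘ suc) i u<w)

∑-update : ∀ {n} (u u′ : Fin n → ℕ) i → (∀ j → j ≢ i → u j ≡ u′ j) → sum u + u′ i ≡ sum u′ + u i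
∑-update {suc n} u u′ i agree = begin
  sum u + u′ i                          ≡⟨ cong (_+ u′ i) (sum-remove u) ⟩
  u i + sum (removeAt u i) + u′ i       ≡⟨ xy∙z≈zy∙x (u i) _ (u′ i) ⟩
  u′ i + sum (removeAt u i) + u i       ≡⟨ cong (λ r → u′ i + r + u i) (sum-cong-≗ λ j → agree _ (punchInᵢ≢i i j)) ⟩
  u′ i + sum (removeAt u′ i) + u i      ≡⟨ cong (_+ u i) (sum-remove u′) ⟨
  sum u′ + u i                          ∎
  where open ≡-Reasoning

tabulate-↭-punchIn : ∀ {a} {A : Set a} {k} (h : Fin (suc k) → A) (x : Fin (suc k)) →
  tabulate h ↭ h x ∷ tabulate (h ∘ punchIn x)
tabulate-↭-punchIn         h zero    = ↭-refl
tabulate-↭-punchIn {k = suc k} h (suc x) =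
  ↭-trans (prep (h zero) (tabulate-↭-punchIn (h ∘ suc) x)) (swap (h zero) (h (suc x)) ↭-refl)

tabulate-↭-two : ∀ {a} {A : Set a} {n} {s t : Fin n} (h h′ : Fin n → A) → s ≢ t →
  (∀ v → v ≢ s → v ≢ t → h v ≡ h′ v) →
  Σ (List A) λ Z → (tabulate h ↭ h t ∷ h s ∷ Z) × (tabulate h′ ↭ h′ t ∷ h′ s ∷ Z)
tabulate-↭-two {n = suc zero}    {zero} {zero} _ _ s≢t _ = contradiction refl s≢t
tabulate-↭-two {n = suc (suc _)} {s}    {t}    h h′ s≢t agree =
  Z , subst (λ v → tabulate h ↭ h t ∷ h v ∷ Z) t↑s′≡s (pick h)
    , subst₂ (λ v Z′ → tabulate h′ ↭ h′ t ∷ h′ v ∷ Z′) t↑s′≡s Z′≡Z (pick h′)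
  where
  s′ = punchOut (s≢t ∘ sym)
  t↑s′≡s : punchIn t s′ ≡ s
  t↑s′≡s = punchIn-punchOut (s≢t ∘ sym)
  pick : ∀ h → tabulate h ↭ h t ∷ h (punchIn t s′) ∷ tabulate (h ∘ punchIn t ∘ punchIn s′)
  pick h = ↭-trans (tabulate-↭-punchIn h t) (prep (h t) (tabulate-↭-punchIn (h ∘ punchIn t) s′))
  Z = tabulate (h ∘ punchIn t ∘ punchIn s′)
  ≢s : ∀ j → punchIn t (punchIn s′ j) ≢ s
  ≢s j eq = punchInᵢ≢i s′ j (punchIn-injective t _ _ (trans eq (sym t↑s′≡s)))
  Z′≡Z : tabulate (h′ ∘ punchIn t ∘ punchIn s′) ≡ Z
  Z′≡Z = sym (tabulate-cong λ j → agree _ (≢s j) (punchInᵢ≢i t _))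

module _ {n : ℕ} where

  degreeSort : (Fin n → ℕ) → List ℕ
  degreeSort ϱ = sortDec (map ϱ (allFin n))

  gap⇒≢ : ∀ {ϱ : Fin n → ℕ} {s t} → ϱ s + 2 ≤ ϱ t → s ≢ t
  gap⇒≢ {ϱ} {s} gap refl = ℕ.<-irrefl refl (ℕ.<-≤-trans (ℕ.m<m+n (ϱ s) (s≤s z≤n)) gap)

  -- ϱ′ = ϱ + 1ₛ − 1ₜ, with both sides moved so that no subtraction occurs.
  record UnitMove (ϱ : Fin n → ℕ) (s t : Fin n) (ϱ′ : Fin n → ℕ) : Set where
    constructor unitMove
    field pointwise : ∀ v → ϱ′ v + indicator (t ≟ᶠ v) ≡ ϱ v + indicator (s ≟ᶠ v)

  open UnitMove public

  module _ {ϱ ϱ′ : Fin n → ℕ} {s t : Fin n} (move : UnitMove ϱ s t ϱ′) where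

    UnitMove-source : s ≢ t → ϱ′ s ≡ suc (ϱ s)
    UnitMove-source s≢t with t ≟ᶠ s | s ≟ᶠ s | pointwise move s
    ... | yes t≡s | _       | _  = contradiction (sym t≡s) s≢t
    ... | no _    | no s≢s  | _  = contradiction refl s≢s
    ... | no _    | yes _   | eq = trans (sym (ℕ.+-identityʳ _)) (trans eq (ℕ.+-comm _ 1))

    UnitMove-target : s ≢ t → suc (ϱ′ t) ≡ ϱ t
    UnitMove-target s≢t with t ≟ᶠ t | s ≟ᶠ t | pointwise move t
    ... | no t≢t | _       | _  = contradiction refl t≢t
    ... | yes _  | yes s≡t | _  = contradiction s≡t s≢t
    ... | yes _  | no _    | eq = trans (ℕ.+-comm 1 _) (trans eq (ℕ.+-identityʳ _))

    UnitMove-other : ∀ {v} → v ≢ s → v ≢ t → ϱ′ v ≡ ϱ v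
    UnitMove-other {v} v≢s v≢t with t ≟ᶠ v | s ≟ᶠ v | pointwise move v
    ... | yes t≡v | _       | _  = contradiction (sym t≡v) v≢t
    ... | no _    | yes s≡v | _  = contradiction (sym s≡v) v≢s
    ... | no _    | no _    | eq = trans (sym (ℕ.+-identityʳ _)) (trans eq (ℕ.+-identityʳ _))

    UnitMove-sym : UnitMove ϱ′ t s ϱ
    UnitMove-sym = unitMove λ v → sym (pointwise move v)

    UnitMove-degreeSort : s ≢ t → Σ (List ℕ) λ Z →
      (degreeSort ϱ ≡ sortDec (suc (ϱ′ t) ∷ ϱ s ∷ Z)) × (degreeSort ϱ′ ≡ sortDec (ϱ′ t ∷ suc (ϱ s) ∷ Z))
    UnitMove-degreeSort s≢t =
      let Z , ϱ↭ , ϱ′↭ = tabulate-↭-two ϱ ϱ′ s≢t λ v v≢s v≢t → sym (UnitMove-other v≢s v≢t)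
      in Z , (begin
        degreeSort ϱ                 ≡⟨ cong sortDec (map-tabulate id ϱ) ⟩
        sortDec (tabulate ϱ)         ≡⟨ sortDec-↭ ϱ↭ ⟩
        sortDec (ϱ t ∷ ϱ s ∷ Z)      ≡⟨ cong (λ x → sortDec (x ∷ ϱ s ∷ Z)) (UnitMove-target s≢t) ⟨
        sortDec (suc (ϱ′ t) ∷ ϱ s ∷ Z) ∎)
           , (begin
        degreeSort ϱ′                ≡⟨ cong sortDec (map-tabulate id ϱ′) ⟩
        sortDec (tabulate ϱ′)        ≡⟨ sortDec-↭ ϱ′↭ ⟩
        sortDec (ϱ′ t ∷ ϱ′ s ∷ Z)    ≡⟨ cong (λ x → sortDec (ϱ′ t ∷ x ∷ Z)) (UnitMove-source s≢t) ⟩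
        sortDec (ϱ′ t ∷ suc (ϱ s) ∷ Z) ∎)
      where open ≡-Reasoning

    UnitMove-spread : ϱ s + 2 ≤ ϱ t → LexLt (degreeSort ϱ′) (degreeSort ϱ)
    UnitMove-spread gap =
      let Z , sortϱ , sortϱ′ = UnitMove-degreeSort s≢t
      in subst₂ LexLt (sym sortϱ′) (sym sortϱ) (sortDec-smooth c<x Z)
      where
      s≢t = gap⇒≢ {ϱ} gap
      c<x : ϱ s < ϱ′ t
      c<x = ℕ.≤-pred (ℕ.≤-trans (ℕ.≤-reflexive (ℕ.+-comm 2 (ϱ s))) (ℕ.≤-trans gap (ℕ.≤-reflexive (sym (UnitMove-target s≢t)))))

    UnitMove-balanced : s ≢ t → ϱ′ t ≤ ϱ s → LexLeq (degreeSort ϱ) (degreeSort ϱ′)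
    UnitMove-balanced s≢t x≤c =
      let Z , sortϱ , sortϱ′ = UnitMove-degreeSort s≢t
      in subst₂ LexLeq (sym sortϱ) (sym sortϱ′) (sortDec-balanced x≤c Z)

  UnitMove-trans : ∀ {ϱ ϱ₁ ϱ₂ : Fin n → ℕ} {s h t} → UnitMove ϱ h t ϱ₁ → UnitMove ϱ₁ s h ϱ₂ → UnitMove ϱ s t ϱ₂
  UnitMove-trans {ϱ} {ϱ₁} {ϱ₂} {s} {h} {t} move₁ move₂ =
    unitMove λ v → ℕ.+-cancelʳ-≡ (𝟙 h v) _ _ (chain v)
    where
    𝟙 : Fin n → Fin n → ℕ
    𝟙 x v = indicator (x ≟ᶠ v)
    chain : ∀ v → ϱ₂ v + 𝟙 t v + 𝟙 h v ≡ ϱ v + 𝟙 s v + 𝟙 h v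
    chain v = begin
      ϱ₂ v + 𝟙 t v + 𝟙 h v   ≡⟨ xy∙z≈xz∙y (ϱ₂ v) _ _ ⟩
      ϱ₂ v + 𝟙 h v + 𝟙 t v   ≡⟨ cong (_+ 𝟙 t v) (pointwise move₂ v) ⟩
      ϱ₁ v + 𝟙 s v + 𝟙 t v   ≡⟨ xy∙z≈xz∙y (ϱ₁ v) _ _ ⟩
      ϱ₁ v + 𝟙 t v + 𝟙 s v   ≡⟨ cong (_+ 𝟙 s v) (pointwise move₁ v) ⟩
      ϱ v + 𝟙 h v + 𝟙 s v    ≡⟨ xy∙z≈xz∙y (ϱ v) _ _ ⟩
      ϱ v + 𝟙 s v + 𝟙 h v    ∎
      where open ≡-Reasoning

≤ᴸ-≤-trans : ∀ a {x y} → a ≤ᴸ x → x ≤ y → a ≤ᴸ y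
≤ᴸ-≤-trans nothing  _   _   = _
≤ᴸ-≤-trans (just _) a≤x x≤y = ℤ.≤-trans a≤x (ℤ.+≤+ x≤y)

≤ᴸ-<-trans : ∀ a {x y} → a ≤ᴸ x → x < y → a <ᴸ y
≤ᴸ-<-trans nothing  _   _   = _
≤ᴸ-<-trans (just _) a≤x x<y = ℤ.≤-<-trans a≤x (ℤ.+<+ x<y)

<ᴸ-pred : ∀ a {x} → a <ᴸ suc x → a ≤ᴸ x
<ᴸ-pred nothing  _              = _
<ᴸ-pred (just _) (ℤ.+<+ a<1+x) = ℤ.+≤+ (ℕ.≤-pred a<1+x)
<ᴸ-pred (just _) ℤ.-<+          = ℤ.-≤+

≤-≤ᵁ-trans : ∀ b {x y} → x ≤ y → y ≤ᵁ b → x ≤ᵁ b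
≤-≤ᵁ-trans nothing  _   _   = _
≤-≤ᵁ-trans (just _) x≤y y≤b = ℤ.≤-trans (ℤ.+≤+ x≤y) y≤b

<-≤ᵁ-trans : ∀ b {x y} → x < y → y ≤ᵁ b → x <ᵁ b
<-≤ᵁ-trans nothing  _   _   = _
<-≤ᵁ-trans (just _) x<y y≤b = ℤ.<-≤-trans (ℤ.+<+ x<y) y≤b

<ᵁ⇒suc≤ᵁ : ∀ b {x} → x <ᵁ b → suc x ≤ᵁ b
<ᵁ⇒suc≤ᵁ nothing  _             = _
<ᵁ⇒suc≤ᵁ (just _) (ℤ.+<+ x<b) = ℤ.+≤+ x<b

module _ {n} (f : Fin n → LowerBound) (g : Fin n → UpperBound) where

  InBounds : (Fin n → ℕ) → Set
  InBounds ϱ = ∀ v → f v ≤ᴸ ϱ v × ϱ v ≤ᵁ g v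

  UnitMove-InBounds : ∀ {ϱ ϱ′ s t} → UnitMove ϱ s t ϱ′ → s ≢ t → InBounds ϱ →
    ϱ s <ᵁ g s → f t <ᴸ ϱ t → InBounds ϱ′
  UnitMove-InBounds {ϱ} {ϱ′} {s} {t} move s≢t bounds ϱs<g f<ϱt v with v ≟ᶠ s | v ≟ᶠ t
  ... | yes refl | _ =
    ≤ᴸ-≤-trans (f s) (proj₁ (bounds s)) (ℕ.≤-trans (ℕ.n≤1+n _) (ℕ.≤-reflexive (sym ϱ′s≡1+ϱs))) ,
    subst (_≤ᵁ g s) (sym ϱ′s≡1+ϱs) (<ᵁ⇒suc≤ᵁ (g s) ϱs<g)
    where ϱ′s≡1+ϱs = UnitMove-source move s≢t
  ... | no _ | yes refl =
    <ᴸ-pred (f t) (subst (f t <ᴸ_) (sym 1+ϱ′t≡ϱt) f<ϱt) ,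
    ≤-≤ᵁ-trans (g t) (ℕ.≤-trans (ℕ.n≤1+n _) (ℕ.≤-reflexive 1+ϱ′t≡ϱt)) (proj₂ (bounds t))
    where 1+ϱ′t≡ϱt = UnitMove-target move s≢t
  ... | no v≢s | no v≢t = subst (λ x → f v ≤ᴸ x × x ≤ᵁ g v) (sym (UnitMove-other move v≢s v≢t)) (bounds v)

Reversed : ∀ {n} (G : Graph n) → Orientation G → Orientation G → Fin (m G) → Set
Reversed G D D′ i = D′ i ≡ not (D i)

agree-or-reversed : ∀ x y → y ≡ x ⊎ y ≡ not x
agree-or-reversed false false = inj₁ refl
agree-or-reversed false true  = inj₂ refl
agree-or-reversed true  false = inj₂ refl
agree-or-reversed true  true  = inj₁ refl

module _ {n} (G : Graph n) where

  open DecMembership (_≟ᶠ_ {m G}) using (_∈?_)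

  headOf-agree : ∀ D D′ {i} → D′ i ≡ D i → headOf G D′ i ≡ headOf G D i
  headOf-agree D D′ {i} D′i≡Di with D′ i | D i
  ... | false | false = refl
  ... | true  | true  = refl

  headOf-reversed : ∀ D D′ {i} → Reversed G D D′ i → headOf G D′ i ≡ tailOf G D i
  headOf-reversed D D′ {i} rev with D′ i | D i
  ... | false | true  = refl
  ... | true  | false = refl

  headOf≢tailOf : ∀ D i → headOf G D i ≢ tailOf G D i
  headOf≢tailOf D i with D i
  ... | false = loopless G i ∘ sym
  ... | true  = loopless G i

  inDeg-∑ : ∀ D v → inDeg G D v ≡ ∑[ i < m G ] indicator (headOf G D i ≟ᶠ v)
  inDeg-∑ D v = length-filter-tabulate (λ i → headOf G D i ≟ᶠ v) id

  inDeg-mono : ∀ D D′ v → (∀ i → headOf G D i ≡ v → headOf G D′ i ≡ v) → inDeg G D v ≤ inDeg G D′ v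
  inDeg-mono D D′ v entering = subst₂ _≤_ (sym (inDeg-∑ D v)) (sym (inDeg-∑ D′ v))
    (∑-mono-≤ λ i → indicator-mono (entering i) _ _)

  inDeg-cong : ∀ {D D′} → (∀ i → D i ≡ D′ i) → ∀ v → inDeg G D v ≡ inDeg G D′ v
  inDeg-cong {D} {D′} D≗D′ v = subst₂ _≡_ (sym (inDeg-∑ D v)) (sym (inDeg-∑ D′ v))
    (sum-cong-≗ λ i → cong (λ x → indicator (x ≟ᶠ v)) (headOf-agree D′ D (D≗D′ i)))

  inDeg-update : ∀ F F′ i → (∀ j → j ≢ i → F j ≡ F′ j) →
    UnitMove (inDeg G F) (headOf G F′ i) (headOf G F i) (inDeg G F′)
  inDeg-update F F′ i agree = unitMove λ v →
    subst₂ (λ x y → x + indicator (headOf G F i ≟ᶠ v) ≡ y + indicator (headOf G F′ i ≟ᶠ v))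
      (sym (inDeg-∑ F′ v)) (sym (inDeg-∑ F v))
      (sym (∑-update _ _ i λ j j≢i → cong (λ x → indicator (x ≟ᶠ v)) (headOf-agree F′ F (agree j j≢i))))

  opaque
    patch : List (Fin (m G)) → Orientation G → Orientation G → Orientation G
    patch A E X j = if does (j ∈? A) then E j else X j

    patch-∈ : ∀ {A E X j} → j ∈ A → patch A E X j ≡ E j
    patch-∈ {A} {j = j} j∈A with j ∈? A
    ... | yes _   = refl
    ... | no j∉A = contradiction j∈A j∉A

    patch-∉ : ∀ {A E X j} → j ∉ A → patch A E X j ≡ X j
    patch-∉ {A} {j = j} j∉A with j ∈? A
    ... | yes j∈A = contradiction j∈A j∉A
    ... | no _    = refl

  patch-∷ : ∀ {A E X i j} → j ≢ i → patch (i ∷ A) E X j ≡ patch A E X j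
  patch-∷ {A} {E} {X} {i} {j} j≢i with toSum (j ∈? A)
  ... | inj₁ j∈A = trans (patch-∈ (there j∈A)) (sym (patch-∈ j∈A))
  ... | inj₂ j∉A = trans (patch-∉ λ { (here j≡i) → j≢i j≡i ; (there j∈A) → j∉A j∈A })
                        (sym (patch-∉ j∉A))

  Reversed-patch⁻ : ∀ {A D X j} → Reversed G D (patch A D X) j → Reversed G D X j
  Reversed-patch⁻ {A} {D} {X} {j} rev with toSum (j ∈? A)
  ... | inj₁ j∈A = contradiction (trans (sym (patch-∈ j∈A)) rev) (Bool.not-¬ refl)
  ... | inj₂ j∉A = trans (sym (patch-∉ j∉A)) rev

  disagreements : Orientation G → Orientation G → ℕ
  disagreements D D′ = ∑[ i < m G ] indicator (¬? (D′ i Bool.≟ D i))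

  disagreements-patch : ∀ {A D D′ i} → All (Reversed G D D′) A → i ∈ A →
    disagreements D (patch A D D′) < disagreements D D′
  disagreements-patch {A} {D} {D′} {i} rev i∈A =
    ∑-mono-< fewer i (subst₂ _<_ (sym restoredᵢ) (sym reversedᵢ) ℕ.≤-refl)
    where
    D″ = patch A D D′
    differs : ∀ E j → Dec (E j ≢ D j)
    differs E j = ¬? (E j Bool.≟ D j)
    fewer : ∀ j → indicator (differs D″ j) ≤ indicator (differs D′ j)
    fewer j with toSum (j ∈? A)
    ... | inj₁ j∈A = indicator-mono (λ ≢ → contradiction (patch-∈ j∈A) ≢) (differs D″ j) (differs D′ j)
    ... | inj₂ j∉A = indicator-mono (λ ≢ → ≢ ∘ trans (patch-∉ j∉A)) (differs D″ j) (differs D′ j)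
    restoredᵢ : indicator (differs D″ i) ≡ 0
    restoredᵢ = indicator-no (λ ≢ → ≢ (patch-∈ i∈A)) (differs D″ i)
    reversedᵢ : indicator (differs D′ i) ≡ 1
    reversedᵢ = indicator-yes (λ ≡ → Bool.not-¬ refl (trans (sym ≡) (All.lookup rev i∈A))) (differs D′ i)

  arcs : ∀ {D s t} → Walk G D s t → List (Fin (m G))
  arcs []      = []
  arcs (i ∷ w) = i ∷ arcs w

  tailOf-∈-walkNodes : ∀ {D s t i} (w : Walk G D s t) → i ∈ arcs w → tailOf G D i ∈ walkNodes w
  tailOf-∈-walkNodes (_ ∷ _) (here refl)  = here refl
  tailOf-∈-walkNodes (_ ∷ w) (there i∈w)  = there (tailOf-∈-walkNodes w i∈w)

  inDeg-reverseWalk : ∀ {D E s t} (w : Walk G D s t) → Unique (walkNodes w) → All (λ j → E j ≡ D j) (arcs w) →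
    UnitMove (inDeg G E) s t (inDeg G (patch (arcs w) (not ∘ D) E))
  inDeg-reverseWalk []      _                    _                 =
    unitMove λ v → cong (_+ _) (inDeg-cong (λ _ → patch-∉ λ ()) v)
  inDeg-reverseWalk {D} {E} (i ∷ w) (tail∉w ∷ unique) (Ei≡Di ∷ agree) =
    UnitMove-trans (inDeg-reverseWalk w unique agree)
      (subst₂ (λ x y → UnitMove (inDeg G X) x y (inDeg G Y)) (headOf-reversed D Y Yi) (headOf-agree D X Xi)
        (inDeg-update X Y i λ j j≢i → sym (patch-∷ {arcs w} {not ∘ D} {E} j≢i)))
    where
    X = patch (arcs w) (not ∘ D) E
    Y = patch (i ∷ arcs w) (not ∘ D) E
    Xi : X i ≡ D i
    Xi = trans (patch-∉ λ i∈w → All.lookup tail∉w (tailOf-∈-walkNodes w i∈w) refl) Ei≡Di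
    Yi : Reversed G D Y i
    Yi = patch-∈ (here refl)

  PathAlong : Orientation G → (Fin (m G) → Set) → Fin n → Fin n → Set
  PathAlong D Q s t = Σ (DiPath G D s t) λ p → All Q (arcs (DiPath.walk p))

  suffixPath : ∀ {D Q x s t} (w : Walk G D x t) → Unique (walkNodes w) → All Q (arcs w) →
    s ∈ walkNodes w → PathAlong D Q s t
  suffixPath []      unique       q       (here refl)  = record { walk = [] ; distinct = unique } , q
  suffixPath (i ∷ w) unique       q       (here refl)  = record { walk = i ∷ w ; distinct = unique } , q
  suffixPath (_ ∷ w) (_ ∷ unique) (_ ∷ q) (there s∈w) = suffixPath w unique q s∈w

  walk⇒path : ∀ {D Q s t} (w : Walk G D s t) → All Q (arcs w) → PathAlong D Q s t
  walk⇒path []      q        = record { walk = [] ; distinct = [] ∷ [] } , q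
  walk⇒path {D} (i ∷ w) (qi ∷ q) with walk⇒path w q
  ... | p , qp with toSum (Any.any? (tailOf G D i ≟ᶠ_) (walkNodes (DiPath.walk p)))
  ...   | inj₁ tail∈p = suffixPath (DiPath.walk p) (DiPath.distinct p) qp tail∈p
  ...   | inj₂ tail∉p = record { walk = i ∷ DiPath.walk p
                               ; distinct = ¬Any⇒All¬ _ tail∉p ∷ DiPath.distinct p } , qi ∷ qp

  record DeficitWalk (D D′ : Orientation G) (s : Fin n) : Set where
    field
      target   : Fin n
      deficit  : inDeg G D′ target < inDeg G D target
      walk     : Walk G D s target
      reversed : All (Reversed G D D′) (arcs walk)

  surplus⇒reversedOutArc : ∀ D D′ {s} → inDeg G D s < inDeg G D′ s →
    Σ (Fin (m G)) λ i → tailOf G D i ≡ s × Reversed G D D′ i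
  surplus⇒reversedOutArc D D′ {s} surplus
    with any? (λ i → (tailOf G D i ≟ᶠ s) ×-dec (D′ i Bool.≟ not (D i)))
  ... | yes found = found
  ... | no none   = contradiction surplus (ℕ.≤⇒≯ (inDeg-mono D′ D s entering))
    where
    entering : ∀ i → headOf G D′ i ≡ s → headOf G D i ≡ s
    entering i head≡s with agree-or-reversed (D i) (D′ i)
    ... | inj₁ same = trans (sym (headOf-agree D D′ same)) head≡s
    ... | inj₂ rev  = contradiction (i , trans (sym (headOf-reversed D D′ rev)) head≡s , rev) none

  -- If the head h of a reversed arc s → h has no deficit, restoring that arc gives h
  -- a surplus, with one disagreement fewer.
  deficitWalk : ∀ D D′ {s} → Acc _<_ (disagreements D D′) → inDeg G D s < inDeg G D′ s → DeficitWalk D D′ s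
  deficitWalk D D′ (acc rec) surplus with surplus⇒reversedOutArc D D′ surplus
  ... | i , refl , rev with inDeg G D′ (headOf G D i) <? inDeg G D (headOf G D i)
  ...   | yes deficit = record { target = headOf G D i ; deficit = deficit ; walk = i ∷ [] ; reversed = rev ∷ [] }
  ...   | no ¬deficit = record
    { target   = DeficitWalk.target W
    ; deficit  = subst (_< inDeg G D t) (UnitMove-other move t≢h t≢s) (DeficitWalk.deficit W)
    ; walk     = i ∷ DeficitWalk.walk W
    ; reversed = rev ∷ All.map Reversed-patch⁻ (DeficitWalk.reversed W)
    }
    where
    h = headOf G D i
    s = tailOf G D i
    D₁ = patch (i ∷ []) D D′
    move : UnitMove (inDeg G D′) h s (inDeg G D₁)
    move = subst₂ (λ x y → UnitMove (inDeg G D′) x y (inDeg G D₁))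
      (headOf-agree D D₁ (patch-∈ (here refl))) (headOf-reversed D D′ rev)
      (inDeg-update D′ D₁ i λ j j≢i → sym (patch-∉ λ { (here j≡i) → j≢i j≡i }))
    h≢s = headOf≢tailOf D i
    surplus₁ : inDeg G D h < inDeg G D₁ h
    surplus₁ = subst (inDeg G D h <_) (sym (UnitMove-source move h≢s)) (s≤s (ℕ.≮⇒≥ ¬deficit))
    W = deficitWalk D D₁ (rec (disagreements-patch (rev ∷ []) (here refl))) surplus₁
    t = DeficitWalk.target W
    t≢h : t ≢ h
    t≢h t≡h = ℕ.<-asym surplus₁ (subst (λ x → inDeg G D₁ x < inDeg G D x) t≡h (DeficitWalk.deficit W))
    t≢s : t ≢ s
    t≢s t≡s = ℕ.<⇒≱ (subst (λ x → inDeg G D₁ x < inDeg G D x) t≡s (DeficitWalk.deficit W))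
      (ℕ.≤-pred (subst (inDeg G D s <_) (sym (UnitMove-target move h≢s)) surplus))

  inDeg-restorePath : ∀ {D D′ s t} (p : DiPath G D s t) → All (Reversed G D D′) (arcs (DiPath.walk p)) →
    UnitMove (inDeg G (patch (arcs (DiPath.walk p)) D D′)) s t (inDeg G D′)
  inDeg-restorePath {D} {D′} {s} {t} p rev = unitMove λ v →
    subst (λ x → x + indicator (t ≟ᶠ v) ≡ inDeg G (patch A D D′) v + indicator (s ≟ᶠ v)) (inDeg-cong restored v)
    (pointwise (inDeg-reverseWalk (DiPath.walk p) (DiPath.distinct p) (All.tabulate (patch-∈))) v)
    where
    A = arcs (DiPath.walk p)
    restored : ∀ j → patch A (not ∘ D) (patch A D D′) j ≡ D′ j
    restored j with toSum (j ∈? A)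
    ... | inj₁ j∈A = trans (patch-∈ j∈A) (sym (All.lookup rev j∈A))
    ... | inj₂ j∉A = trans (patch-∉ j∉A) (patch-∉ j∉A)

  arc-of-walk : ∀ {D s t} → s ≢ t → (w : Walk G D s t) → Σ (Fin (m G)) (_∈ arcs w)
  arc-of-walk s≢t []      = contradiction refl s≢t
  arc-of-walk s≢t (i ∷ _) = i , here refl

  noSurplus⇒inDeg≡ : ∀ D D′ → (∀ v → ¬ inDeg G D v < inDeg G D′ v) → ∀ v → inDeg G D v ≡ inDeg G D′ v
  noSurplus⇒inDeg≡ D D′ noSurplus v = ℕ.≤-antisym (ℕ.≮⇒≥ noDeficit) (ℕ.≮⇒≥ (noSurplus v))
    where
    noDeficit : ¬ inDeg G D′ v < inDeg G D v
    noDeficit deficit = noSurplus (DeficitWalk.target W) (DeficitWalk.deficit W)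
      where W = deficitWalk D′ D (<-wellFounded _) deficit

module _ {n} (G : Graph n) (f : Fin n → LowerBound) (g : Fin n → UpperBound) where

  ImprovingPath : Orientation G → Set
  ImprovingPath D = Σ (Fin n) λ s → Σ (Fin n) λ t →
    DiPath G D s t × (inDeg G D s + 2 ≤ inDeg G D t) × (inDeg G D s <ᵁ g s) × (f t <ᴸ inDeg G D t)

  decMin⇒¬improvingPath : ∀ {D} → Bounded G f g D → DecMin G f g D → ¬ ImprovingPath D
  decMin⇒¬improvingPath {D} bounded decMin (s , t , path , gap , s<g , f<t) =
    LexLeq⇒¬LexLt (decMin D′ (UnitMove-InBounds f g move (gap⇒≢ gap) bounded s<g f<t)) (UnitMove-spread move gap)
    where
    D′ = patch G (arcs G (DiPath.walk path)) (not ∘ D) D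
    move = inDeg-reverseWalk G (DiPath.walk path) (DiPath.distinct path) (All.tabulate λ _ → refl)

  ¬improvingPath⇒below : ∀ {D} → Bounded G f g D → ¬ ImprovingPath D →
    ∀ D′ → Acc _<_ (disagreements G D D′) → Bounded G f g D′ → LexLeq (degreeSort (inDeg G D)) (degreeSort (inDeg G D′))
  ¬improvingPath⇒below {D} bounded noPath D′ (acc rec) bounded′ with any? (λ v → inDeg G D v <? inDeg G D′ v)
  ... | no noSurplus = subst (λ xs → LexLeq (degreeSort (inDeg G D)) (sortDec xs))
                             (map-cong (noSurplus⇒inDeg≡ G D D′ λ v surplus → noSurplus (v , surplus)) (allFin n))
                             (LexLeq-refl _)
  ... | yes (s , surplus) = LexLeq-trans (¬improvingPath⇒below bounded noPath D″ (rec closer) bounded″)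
                                         (UnitMove-balanced move s≢t balanced)
    where
    W = deficitWalk G D D′ (<-wellFounded _) surplus
    t = DeficitWalk.target W
    deficit = DeficitWalk.deficit W
    P = walk⇒path G (DeficitWalk.walk W) (DeficitWalk.reversed W)
    p = proj₁ P
    A = arcs G (DiPath.walk p)
    D″ = patch G A D D′
    s≢t : s ≢ t
    s≢t s≡t = ℕ.<-asym surplus (subst (λ x → inDeg G D′ x < inDeg G D x) (sym s≡t) deficit)
    move : UnitMove (inDeg G D″) s t (inDeg G D′)
    move = inDeg-restorePath G p (proj₂ P)
    closer : disagreements G D D″ < disagreements G D D′
    closer = disagreements-patch G (proj₂ P) (proj₂ (arc-of-walk G s≢t (DiPath.walk p)))
    bounded″ : Bounded G f g D″
    bounded″ = UnitMove-InBounds f g (UnitMove-sym move) (s≢t ∘ sym) bounded′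
      (<-≤ᵁ-trans (g t) deficit (proj₂ (bounded t))) (≤ᴸ-<-trans (f s) (proj₁ (bounded s)) surplus)
    noGap : ¬ (inDeg G D s + 2 ≤ inDeg G D t)
    noGap gap = noPath (s , t , p , gap , <-≤ᵁ-trans (g s) surplus (proj₂ (bounded′ s))
                                        , ≤ᴸ-<-trans (f t) (proj₁ (bounded′ t)) deficit)
    ϱt≤1+ϱs : inDeg G D t ≤ suc (inDeg G D s)
    ϱt≤1+ϱs = ℕ.≤-pred (subst (inDeg G D t <_) (ℕ.+-comm (inDeg G D s) 2) (ℕ.≰⇒> noGap))
    ϱs≤ϱ″s : inDeg G D s ≤ inDeg G D″ s
    ϱs≤ϱ″s = ℕ.≤-pred (subst (inDeg G D s <_) (UnitMove-source move s≢t) surplus)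
    balanced : inDeg G D′ t ≤ inDeg G D″ s
    balanced = ℕ.≤-pred (ℕ.<-≤-trans deficit (ℕ.≤-trans ϱt≤1+ϱs (s≤s ϱs≤ϱ″s)))

theorem9p1 : ∀ {n} (G : Graph n) (f : Fin n → LowerBound) (g : Fin n → UpperBound) →
    (∀ v → f v ≤ᴸᵁ g v) →
    Σ (Orientation G) (Bounded G f g) →
    (D : Orientation G) → Bounded G f g D →
    DecMin G f g D ⇔
      (¬ Σ (Fin n) λ s → Σ (Fin n) λ t →
          DiPath G D s t × (inDeg G D s + 2 ≤ inDeg G D t) × (inDeg G D s <ᵁ g s) × (f t <ᴸ inDeg G D t))
-- The hypotheses f ≤ g and existence of a bounded orientation follow from D being bounded.
theorem9p1 G f g _ _ D bounded = mk⇔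
  (decMin⇒¬improvingPath G f g bounded)
  (λ noPath D′ bounded′ → ¬improvingPath⇒below G f g bounded noPath D′ (<-wellFounded _) bounded′)
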